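{- Let $d\ge 1$ be an integer. For positive integers $k$ define $A_d(k)=k$ if $k\leq d+1$ and $A_d(k)=d\binom{k-1}{d}+1$ if $k>d+1$, and define $B_d(k)=k(A_d(k)-1)+1$. Let $F=\{X_1,\dots,X_m\}$ be a family of finite sets in $\mathbb{R}^d$. If \[\varphi\Big(\bigcup_{i\in I}X_i\Big)\geq B_d(|I|)\] for every non-empty subset $I\subset\{1,\dots,m\}$, then $F$ has a system of general position representatives.
   Context: A subset $X\subset\mathbb{R}^d$ is in general position if every subset of $X$ of size at most $d+1$ is affinely independent. For a finite set $X\subset\mathbb{R}^d$, $\varphi(X)$ denotes the maximal size of a subset of $X$ in general position. A system of general position representatives of $F=\{X_1,\dots,X_m\}$ is a set $\{x_1,\dots,x_m\}$ in general position with $x_i\in X_i$ for all $i$. -}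

module Defs where

open import Level using (0ℓ)
open import Data.Nat as ℕ using (ℕ; zero; suc; _≤?_)
open import Data.Nat.Combinatorics using (_C_)
open import Data.Fin using (Fin; zero; suc)
open import Data.Fin.Subset as Sub using (Subset)
open import Data.Vec using (Vec; lookup)
open import Data.List using (List)
open import Data.List.Membership.Propositional using () renaming (_∈_ to _∈ₗ_)
open import Data.Product using (Σ; ∃; _×_; _,_)
open import Data.Sum using (_⊎_)
open import Function.Definitions using (Injective)
open import Relation.Nullary using (¬_; yes; no)
open import Relation.Binary.PropositionalEquality using (_≡_)

-- The real numbers, axiomatised as a (Dedekind/sup-)complete ordered
-- field.  The theorem is stated for every model of this record; classically
-- every model is isomorphic to ℝ.

record RealField : Set₁ where
  infixl 6 _+_
  infixl 7 _*_
  infix 4 _≤_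
  field
    Carrier : Set
    0# 1# : Carrier
    _+_ _*_ : Carrier → Carrier → Carrier
    -_ : Carrier → Carrier
    _≤_ : Carrier → Carrier → Set
    +-assoc : ∀ x y z → (x + y) + z ≡ x + (y + z)
    +-comm : ∀ x y → x + y ≡ y + x
    +-identityˡ : ∀ x → 0# + x ≡ x
    -‿inverseˡ : ∀ x → (- x) + x ≡ 0#
    *-assoc : ∀ x y z → (x * y) * z ≡ x * (y * z)
    *-comm : ∀ x y → x * y ≡ y * x
    *-identityˡ : ∀ x → 1# * x ≡ x
    distribˡ : ∀ x y z → x * (y + z) ≡ (x * y) + (x * z)
    0≢1 : ¬ (0# ≡ 1#)
    inverse : ∀ x → ¬ (x ≡ 0#) → ∃ λ y → x * y ≡ 1#
    ≤-refl : ∀ x → x ≤ x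
    ≤-trans : ∀ {x y z} → x ≤ y → y ≤ z → x ≤ z
    ≤-antisym : ∀ {x y} → x ≤ y → y ≤ x → x ≡ y
    ≤-total : ∀ x y → x ≤ y ⊎ y ≤ x
    +-mono-≤ : ∀ {x y} z → x ≤ y → x + z ≤ y + z
    *-nonneg : ∀ {x y} → 0# ≤ x → 0# ≤ y → 0# ≤ x * y
    sup : (S : Carrier → Set) → (∃ λ x → S x) →
          (∃ λ b → ∀ x → S x → x ≤ b) →
          ∃ λ s → (∀ x → S x → x ≤ s) × (∀ b → (∀ x → S x → x ≤ b) → s ≤ b)

module _ (ℝ : RealField) where
  open RealField ℝ

  Point : ℕ → Set
  Point d = Vec Carrier d

  sumF : ∀ {k} → (Fin k → Carrier) → Carrier
  sumF {zero} f = 0#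
  sumF {suc k} f = f zero + sumF (λ i → f (suc i))

  AffinelyIndependent : ∀ {d k} → (Fin k → Point d) → Set
  AffinelyIndependent {d} {k} p =
    ∀ (λ' : Fin k → Carrier) →
      sumF λ' ≡ 0# →
      (∀ (c : Fin d) → sumF (λ i → λ' i * lookup (p i) c) ≡ 0#) →
      ∀ i → λ' i ≡ 0#

  InGeneralPosition : ∀ {d n} → (Fin n → Point d) → Set
  InGeneralPosition {d} {n} y =
    ∀ (k : ℕ) → k ℕ.≤ suc d → (ι : Fin k → Fin n) → Injective _≡_ _≡_ ι →
      AffinelyIndependent (λ j → y (ι j))

  -- φ(X) ≥ n  for a set X ⊂ ℝ^d given by a membership predicate:
  -- X contains n distinct points in general position
  φ≥ : ∀ {d} → (Point d → Set) → ℕ → Set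
  φ≥ {d} X n = Σ (Fin n → Point d) λ y →
    Injective _≡_ _≡_ y × (∀ j → X (y j)) × InGeneralPosition y

  ⋃ : ∀ {d m} → (Fin m → List (Point d)) → Subset m → Point d → Set
  ⋃ X I p = ∃ λ i → i Sub.∈ I × p ∈ₗ X i

  SystemOfGPRepresentatives : ∀ {d m} → (Fin m → List (Point d)) → Set
  SystemOfGPRepresentatives {d} {m} X = Σ (Fin m → Point d) λ x →
    (∀ i → x i ∈ₗ X i) × Injective _≡_ _≡_ x × InGeneralPosition x

A : ℕ → ℕ → ℕ
A d k with k ≤? suc d
... | yes _ = k
... | no _ = d ℕ.* ((k ℕ.∸ 1) C d) ℕ.+ 1

B : ℕ → ℕ → ℕ
B d k = k ℕ.* (A d k ℕ.∸ 1) ℕ.+ 1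

module Submission where

-- Applied to all m sets, the hypothesis gives m (A(m) - 1) + 1 points of the union
-- in general position, so some X i₀ contains A(m) of them. By induction the other m - 1 sets have
-- representatives S in general position, and one of those A(m) points z can be added to S. If z ∪ S
-- is not in general position, z is affinely dependent on some t = min(m - 1, d) points of S; but no
-- t + 1 affinely independent points all depend on the same t independent points (after lifting to
-- homogeneous coordinates they would be t + 1 independent vectors in a t-dimensional span), and
-- A(m) > t · C(m - 1, t), so some z is not blocked by any t-subset of S.
-- The reals are only an ordered field with suprema, without decidable equality: the supremum gives
-- a weak excluded middle, and Gaussian elimination makes affine independence ¬¬-stable, which turns
-- the counting argument into an actual choice of z.

open import Defs
open import Level using (0ℓ)
open import Algebra.Bundles using (CommutativeRing)
import Algebra.Consequences.Propositional as Consequences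
open import Data.Empty using (⊥-elim)
open import Data.Fin using (Fin; zero; suc; punchIn; punchOut; inject≤)
open import Data.Nat using (ℕ; zero; suc; z≤n; s≤s)
import Data.Nat.Properties as ℕ
open import Data.Product using (∃; _,_; _×_; proj₁; proj₂)
open import Data.Sum using (_⊎_; inj₁; inj₂)
open import Relation.Binary.PropositionalEquality
  using (_≡_; refl; sym; trans; cong; cong₂; subst; subst₂; isEquivalence; module ≡-Reasoning)
open import Relation.Nullary using (¬_; does; yes; no)
open import Function using (_∘_)
open import Relation.Nullary.Decidable using (dec-true; dec-false)
open import Data.Bool using (if_then_else_)
open import Function.Definitions using (Injective)
import Data.Fin.Properties as Fin

¬¬-∀Fin : ∀ {n} {P : Fin n → Set} → (∀ i → ¬ ¬ P i) → ¬ ¬ (∀ i → P i)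
¬¬-∀Fin {zero} _ k = k λ ()
¬¬-∀Fin {suc n} {P} h k = h zero λ p₀ → ¬¬-∀Fin {n} (λ i → h (suc i)) λ ps →
  k λ { zero → p₀ ; (suc i) → ps i }

module OrderedField (ℝ : RealField) where
  open RealField ℝ public hiding (_≤_)
  open RealField ℝ using (_≤_)

  commutativeRing : CommutativeRing 0ℓ 0ℓ
  commutativeRing = record
    { isCommutativeRing = record
      { isRing = record
        { +-isAbelianGroup = record
          { isGroup = record
            { isMonoid = record
              { isSemigroup = record
                { isMagma = record { isEquivalence = isEquivalence ; ∙-cong = cong₂ _+_ }
                ; assoc = +-assoc }
              ; identity = Consequences.comm∧idˡ⇒id +-comm +-identityˡ }
            ; inverse = Consequences.comm∧invˡ⇒inv +-comm -‿inverseˡ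
            ; ⁻¹-cong = cong -_ }
          ; comm = +-comm }
        ; *-cong = cong₂ _*_
        ; *-assoc = *-assoc
        ; *-identity = Consequences.comm∧idˡ⇒id *-comm *-identityˡ
        ; distrib = distribˡ , Consequences.comm∧distrˡ⇒distrʳ *-comm distribˡ }
      ; *-comm = *-comm } }

  open CommutativeRing commutativeRing public
    using (ring; semiring; *-commutativeSemigroup; +-identityʳ; -‿inverseʳ; *-identityʳ; zeroˡ; zeroʳ)
  open import Algebra.Properties.Ring ring public using (-1*x≈-x; -‿involutive; -‿distribˡ-*; -‿distribʳ-*; +-inverseʳ-unique)
  open import Algebra.Properties.Semiring.Sum semiring public
    using (sum; sum-syntax; ∑-distrib-+; ∑-comm; *-distribˡ-sum; *-distribʳ-sum; sum-cong-≗; sum-replicate-zero)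

  sumF≡sum : ∀ {k} (f : Fin k → Carrier) → sumF ℝ f ≡ sum f
  sumF≡sum {zero} f = refl
  sumF≡sum {suc k} f = cong (f zero +_) (sumF≡sum (λ i → f (suc i)))

  -x*-y≡x*y : ∀ x y → - x * - y ≡ x * y
  -x*-y≡x*y x y = begin
    - x * - y       ≡⟨ sym (-‿distribˡ-* x (- y)) ⟩
    - (x * - y)     ≡⟨ cong -_ (sym (-‿distribʳ-* x y)) ⟩
    - - (x * y)     ≡⟨ -‿involutive (x * y) ⟩
    x * y           ∎
    where open ≡-Reasoning

  1≢0 : ¬ 1# ≡ 0#
  1≢0 1≡0 = 0≢1 (sym 1≡0)

  ≢0∧*≡0⇒≡0 : ∀ {x y} → ¬ x ≡ 0# → x * y ≡ 0# → y ≡ 0#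
  ≢0∧*≡0⇒≡0 {x} {y} x≢0 xy≡0 with inverse x x≢0
  ... | u , xu≡1 = begin
    y             ≡⟨ sym (*-identityˡ y) ⟩
    1# * y        ≡⟨ cong (_* y) (trans (sym xu≡1) (*-comm x u)) ⟩
    (u * x) * y   ≡⟨ *-assoc u x y ⟩
    u * (x * y)   ≡⟨ cong (u *_) xy≡0 ⟩
    u * 0#        ≡⟨ zeroʳ u ⟩
    0#            ∎
    where open ≡-Reasoning

  0≤1 : 0# ≤ 1#
  0≤1 with ≤-total 0# 1#
  ... | inj₁ 0≤1 = 0≤1
  ... | inj₂ 1≤0 = ⊥-elim (1≢0 (≤-antisym 1≤0 0≤[-1]²))
    where
    0≤-1 : 0# ≤ - 1#
    0≤-1 = subst₂ _≤_ (-‿inverseʳ 1#) (+-identityˡ (- 1#)) (+-mono-≤ (- 1#) 1≤0)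
    0≤[-1]² : 0# ≤ 1#
    0≤[-1]² = subst (0# ≤_) (trans (-1*x≈-x (- 1#)) (-‿involutive 1#)) (*-nonneg 0≤-1 0≤-1)

  1≰0 : ¬ 1# ≤ 0#
  1≰0 1≤0 = 1≢0 (≤-antisym 1≤0 0≤1)

  -1≤0 : - 1# ≤ 0#
  -1≤0 = subst₂ _≤_ (+-identityˡ (- 1#)) (-‿inverseʳ 1#) (+-mono-≤ (- 1#) 0≤1)

  -- Compare 0 with the supremum of {-1} ∪ {1 | P}: if it is ≤ 0 then P fails,
  -- and if it is ≥ 0 then -1 is not an upper bound, so ¬ P fails.
  weak-excluded-middle : (P : Set) → ¬ P ⊎ ¬ ¬ P
  weak-excluded-middle P with sup S (- 1# , inj₁ refl) (1# , S≤1)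
    where
    S : Carrier → Set
    S z = z ≡ - 1# ⊎ (z ≡ 1# × P)
    S≤1 : ∀ z → S z → z ≤ 1#
    S≤1 _ (inj₁ refl) = ≤-trans -1≤0 0≤1
    S≤1 _ (inj₂ (refl , _)) = ≤-refl 1#
  ... | s , s-upper , s-least with ≤-total s 0#
  ...   | inj₁ s≤0 = inj₁ λ p → 1≰0 (≤-trans (s-upper 1# (inj₂ (refl , p))) s≤0)
  ...   | inj₂ 0≤s = inj₂ λ ¬p → 1≰0 (subst₂ _≤_ (+-identityˡ 1#) (-‿inverseˡ 1#)
                                       (+-mono-≤ 1# (≤-trans 0≤s (s-least (- 1#) (S≤-1 ¬p)))))
    where
    S≤-1 : ¬ P → ∀ z → z ≡ - 1# ⊎ (z ≡ 1# × P) → z ≤ - 1#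
    S≤-1 _ _ (inj₁ refl) = ≤-refl (- 1#)
    S≤-1 ¬p _ (inj₂ (_ , p)) = ⊥-elim (¬p p)

  search : ∀ {M} (Q : Fin M → Set) → (∃ λ j → ¬ ¬ Q j) ⊎ (∀ j → ¬ Q j)
  search {zero} Q = inj₂ λ ()
  search {suc M} Q with weak-excluded-middle (Q zero) | search (λ j → Q (suc j))
  ... | inj₂ ¬¬q₀ | _ = inj₁ (zero , ¬¬q₀)
  ... | inj₁ _ | inj₁ (j , ¬¬qⱼ) = inj₁ (suc j , ¬¬qⱼ)
  ... | inj₁ ¬q₀ | inj₂ ¬q = inj₂ λ { zero → ¬q₀ ; (suc j) → ¬q j }

  ∑-cong : ∀ {k} {f g : Fin k → Carrier} → (∀ i → f i ≡ g i) → ∑[ i < k ] f i ≡ ∑[ i < k ] g i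
  ∑-cong = sum-cong-≗

  ∑-zero : ∀ {k} {f : Fin k → Carrier} → (∀ i → f i ≡ 0#) → ∑[ i < k ] f i ≡ 0#
  ∑-zero {k} f≡0 = trans (∑-cong f≡0) (sum-replicate-zero k)

  ∑-∑-reassoc : ∀ {m n} (α : Fin m → Carrier) (M : Fin m → Fin n → Carrier) (w : Fin n → Carrier) →
    ∑[ a < m ] (α a * ∑[ b < n ] (M a b * w b)) ≡ ∑[ b < n ] (∑[ a < m ] (α a * M a b) * w b)
  ∑-∑-reassoc {m} {n} α M w = begin
    ∑[ a < m ] (α a * ∑[ b < n ] (M a b * w b))
      ≡⟨ ∑-cong (λ a → *-distribˡ-sum (α a) (λ b → M a b * w b)) ⟩
    ∑[ a < m ] ∑[ b < n ] (α a * (M a b * w b))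
      ≡⟨ ∑-cong (λ a → ∑-cong λ b → sym (*-assoc (α a) (M a b) (w b))) ⟩
    ∑[ a < m ] ∑[ b < n ] (α a * M a b * w b)
      ≡⟨ ∑-comm (λ a b → α a * M a b * w b) ⟩
    ∑[ b < n ] ∑[ a < m ] (α a * M a b * w b)
      ≡⟨ ∑-cong (λ b → sym (*-distribʳ-sum (w b) (λ a → α a * M a b))) ⟩
    ∑[ b < n ] (∑[ a < m ] (α a * M a b) * w b) ∎
    where open ≡-Reasoning

  δ : ∀ {k} → Fin k → Fin k → Carrier
  δ a i = if does (a Fin.≟ i) then 1# else 0#

  δ-diag : ∀ {k} (a : Fin k) → δ a a ≡ 1#
  δ-diag a = cong (if_then 1# else 0#) (dec-true (a Fin.≟ a) refl)

  δ-off : ∀ {k} {a i : Fin k} → ¬ a ≡ i → δ a i ≡ 0#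
  δ-off {a = a} {i} a≢i = cong (if_then 1# else 0#) (dec-false (a Fin.≟ i) a≢i)

  δ-injective : ∀ {k K} {σ : Fin k → Fin K} → Injective _≡_ _≡_ σ → ∀ a b → δ (σ a) (σ b) ≡ δ b a
  δ-injective {σ = σ} σ-inj a b with a Fin.≟ b
  ... | yes refl = trans (δ-diag (σ a)) (sym (δ-diag a))
  ... | no a≢b = trans (δ-off (a≢b ∘ σ-inj)) (sym (δ-off (a≢b ∘ sym)))

  ∑-δ : ∀ {k} (a : Fin k) (f : Fin k → Carrier) → ∑[ i < k ] (δ a i * f i) ≡ f a
  ∑-δ {suc k} zero f = begin
    1# * f zero + ∑[ i < k ] (0# * f (suc i))
      ≡⟨ cong₂ _+_ (*-identityˡ (f zero)) (∑-zero λ i → zeroˡ (f (suc i))) ⟩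
    f zero + 0#
      ≡⟨ +-identityʳ (f zero) ⟩
    f zero ∎
    where open ≡-Reasoning
  ∑-δ {suc k} (suc a) f = begin
    0# * f zero + ∑[ i < k ] (δ a i * f (suc i))
      ≡⟨ cong (_+ ∑[ i < k ] (δ a i * f (suc i))) (zeroˡ (f zero)) ⟩
    0# + ∑[ i < k ] (δ a i * f (suc i))
      ≡⟨ +-identityˡ _ ⟩
    ∑[ i < k ] (δ a i * f (suc i))
      ≡⟨ ∑-δ a (λ i → f (suc i)) ⟩
    f (suc a) ∎
    where open ≡-Reasoning

module LinearAlgebra (ℝ : RealField) where
  open OrderedField ℝ
  open import Data.Nat using (_≤_)
  open import Data.Vec.Functional using ([]) renaming (_∷_ to _◂_)
  open import Algebra.Properties.CommutativeSemigroup *-commutativeSemigroup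
    using (interchange; x∙yz≈y∙xz; xy∙z≈y∙zx; xy∙z≈zx∙y)

  Family : ℕ → ℕ → Set
  Family k R = Fin k → Fin R → Carrier

  IsRelation : ∀ {k R} → Family k R → (Fin k → Carrier) → Set
  IsRelation {k} v α = ∀ ρ → ∑[ i < k ] (α i * v i ρ) ≡ 0#

  LinearlyIndependent : ∀ {k R} → Family k R → Set
  LinearlyIndependent v = ∀ α → IsRelation v α → ∀ i → α i ≡ 0#

  WeaklyIndependent : ∀ {k R} → Family k R → Set
  WeaklyIndependent v = ∀ α → IsRelation v α → ∀ i → ¬ ¬ α i ≡ 0#

  NontrivialRelation : ∀ {k R} → Family k R → Set
  NontrivialRelation v = ∃ λ α → IsRelation v α × ∃ λ i → ¬ α i ≡ 0#

  LinearlyIndependent-cong : ∀ {k R} {v w : Family k R} → (∀ i ρ → v i ρ ≡ w i ρ) →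
    LinearlyIndependent v → LinearlyIndependent w
  LinearlyIndependent-cong v≗w li α rel = li α λ ρ → trans (∑-cong λ i → cong (α i *_) (v≗w i ρ)) (rel ρ)

  zero-head⇒relation : ∀ {k R} (v : Family (suc k) R) → (∀ ρ → v zero ρ ≡ 0#) →
    IsRelation v (1# ◂ λ _ → 0#)
  zero-head⇒relation {k} v v₀≡0 ρ = begin
    1# * v zero ρ + ∑[ i < k ] (0# * v (suc i) ρ)
      ≡⟨ cong₂ _+_ (trans (*-identityˡ _) (v₀≡0 ρ)) (∑-zero {k} λ i → zeroˡ _) ⟩
    0# + 0#
      ≡⟨ +-identityˡ 0# ⟩
    0# ∎
    where open ≡-Reasoning

  nonzero-coordinate : ∀ {k R} (v : Family (suc k) R) → WeaklyIndependent v → ∃ λ ρ → ¬ v zero ρ ≡ 0#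
  nonzero-coordinate v wi with search (λ ρ → ¬ v zero ρ ≡ 0#)
  ... | inj₁ (ρ , ¬¬v₀≢0) = ρ , λ v₀≡0 → ¬¬v₀≢0 λ v₀≢0 → v₀≢0 v₀≡0
  ... | inj₂ ¬¬v₀≡0 = ⊥-elim (¬¬-∀Fin ¬¬v₀≡0 λ v₀≡0 → wi (1# ◂ λ _ → 0#) (zero-head⇒relation v v₀≡0) zero 1≢0)

  -- One step of Gaussian elimination with pivot v zero ρ₀ = u⁻¹: the rows other than ρ₀
  -- are cleared in the first column and the first column and row ρ₀ are dropped.
  module Elimination {k R} (v : Family (suc k) (suc R)) (ρ₀ : Fin (suc R))
                     (u : Carrier) (pu : v zero ρ₀ * u ≡ 1#) where

    multiplier : Fin R → Carrier
    multiplier ρ = - (v zero (punchIn ρ₀ ρ) * u)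

    reduced : Family k R
    reduced i ρ = v (suc i) (punchIn ρ₀ ρ) + multiplier ρ * v (suc i) ρ₀

    tail-combination : (Fin k → Carrier) → Fin (suc R) → Carrier
    tail-combination α ρ = ∑[ i < k ] (α i * v (suc i) ρ)

    reduced-combination : ∀ α ρ → ∑[ i < k ] (α i * reduced i ρ) ≡
      tail-combination α (punchIn ρ₀ ρ) + multiplier ρ * tail-combination α ρ₀
    reduced-combination α ρ = begin
      ∑[ i < k ] (α i * (a i + c * b i))
        ≡⟨ ∑-cong (λ i → trans (distribˡ (α i) _ _) (cong (α i * a i +_) (x∙yz≈y∙xz (α i) c (b i)))) ⟩
      ∑[ i < k ] (α i * a i + c * (α i * b i))
        ≡⟨ ∑-distrib-+ (λ i → α i * a i) (λ i → c * (α i * b i)) ⟩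
      ∑[ i < k ] (α i * a i) + ∑[ i < k ] (c * (α i * b i))
        ≡⟨ cong (∑[ i < k ] (α i * a i) +_) (sym (*-distribˡ-sum c (λ i → α i * b i))) ⟩
      ∑[ i < k ] (α i * a i) + c * ∑[ i < k ] (α i * b i)
        ∎
      where
      open ≡-Reasoning
      a b : Fin k → Carrier
      a i = v (suc i) (punchIn ρ₀ ρ)
      b i = v (suc i) ρ₀
      c = multiplier ρ

    pivot≢0 : ¬ v zero ρ₀ ≡ 0#
    pivot≢0 p≡0 = 1≢0 (begin
      1#               ≡⟨ sym pu ⟩
      v zero ρ₀ * u    ≡⟨ cong (_* u) p≡0 ⟩
      0# * u           ≡⟨ zeroˡ u ⟩
      0#               ∎)
      where open ≡-Reasoning

    cancel-pivot : ∀ x y → (y * u) * (x * v zero ρ₀) ≡ x * y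
    cancel-pivot x y = begin
      (y * u) * (x * v zero ρ₀)   ≡⟨ *-comm (y * u) _ ⟩
      (x * v zero ρ₀) * (y * u)   ≡⟨ interchange x _ y u ⟩
      (x * y) * (v zero ρ₀ * u)   ≡⟨ cong ((x * y) *_) pu ⟩
      (x * y) * 1#                ≡⟨ *-identityʳ (x * y) ⟩
      x * y                       ∎
      where open ≡-Reasoning

    extend : (Fin k → Carrier) → Fin (suc k) → Carrier
    extend α = - (u * tail-combination α ρ₀) ◂ α

    extend-relation : ∀ α → IsRelation reduced α → IsRelation v (extend α)
    extend-relation α rel ρ with ρ₀ Fin.≟ ρ
    ... | yes refl = begin
      - (u * T₀) * v zero ρ₀ + T₀     ≡⟨ cong (_+ T₀) (sym (-‿distribˡ-* (u * T₀) _)) ⟩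
      - ((u * T₀) * v zero ρ₀) + T₀   ≡⟨ cong (λ x → - x + T₀) (xy∙z≈y∙zx u T₀ _) ⟩
      - (T₀ * (v zero ρ₀ * u)) + T₀   ≡⟨ cong (λ x → - (T₀ * x) + T₀) pu ⟩
      - (T₀ * 1#) + T₀                ≡⟨ cong (λ x → - x + T₀) (*-identityʳ T₀) ⟩
      - T₀ + T₀                       ≡⟨ -‿inverseˡ T₀ ⟩
      0#                              ∎
      where
      open ≡-Reasoning
      T₀ = tail-combination α ρ₀
    ... | no ρ₀≢ρ = subst (λ ρ → ∑[ i < suc k ] (extend α i * v i ρ) ≡ 0#) (Fin.punchIn-punchOut ρ₀≢ρ) (begin
      - (u * T₀) * a + T                ≡⟨ +-comm _ T ⟩
      T + - (u * T₀) * a                ≡⟨ cong (T +_) (sym (-‿distribˡ-* (u * T₀) a)) ⟩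
      T + - ((u * T₀) * a)              ≡⟨ cong (λ x → T + - x) (xy∙z≈zx∙y u T₀ a) ⟩
      T + - ((a * u) * T₀)              ≡⟨ cong (T +_) (-‿distribˡ-* (a * u) T₀) ⟩
      T + multiplier ρ' * T₀            ≡⟨ sym (reduced-combination α ρ') ⟩
      ∑[ i < k ] (α i * reduced i ρ')   ≡⟨ rel ρ' ⟩
      0#                                ∎)
      where
      open ≡-Reasoning
      ρ' = punchOut ρ₀≢ρ
      a = v zero (punchIn ρ₀ ρ')
      T = tail-combination α (punchIn ρ₀ ρ')
      T₀ = tail-combination α ρ₀

    tail-relation : ∀ α → IsRelation v α → IsRelation reduced (λ i → α (suc i))
    tail-relation α rel ρ = begin
      ∑[ i < k ] (α (suc i) * reduced i ρ)           ≡⟨ reduced-combination (λ i → α (suc i)) ρ ⟩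
      T + - (a * u) * T₀                             ≡⟨ cong₂ (λ x y → x + - (a * u) * y)
                                                            (+-inverseʳ-unique _ _ (rel (punchIn ρ₀ ρ)))
                                                            (+-inverseʳ-unique _ _ (rel ρ₀)) ⟩
      - (α₀ * a) + - (a * u) * - (α₀ * p)            ≡⟨ cong (- (α₀ * a) +_) (trans (-x*-y≡x*y _ _) (cancel-pivot α₀ a)) ⟩
      - (α₀ * a) + α₀ * a                            ≡⟨ -‿inverseˡ _ ⟩
      0#                                             ∎
      where
      open ≡-Reasoning
      α₀ = α zero
      p = v zero ρ₀
      a = v zero (punchIn ρ₀ ρ)
      T = tail-combination (λ i → α (suc i)) (punchIn ρ₀ ρ)
      T₀ = tail-combination (λ i → α (suc i)) ρ₀

    head-zero : ∀ α → IsRelation v α → (∀ i → α (suc i) ≡ 0#) → α zero ≡ 0#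
    head-zero α rel tail≡0 = ≢0∧*≡0⇒≡0 pivot≢0 (begin
      v zero ρ₀ * α zero                                        ≡⟨ *-comm _ _ ⟩
      α zero * v zero ρ₀                                        ≡⟨ sym (+-identityʳ _) ⟩
      α zero * v zero ρ₀ + 0#                                   ≡⟨ cong (α zero * v zero ρ₀ +_) (sym T≡0) ⟩
      α zero * v zero ρ₀ + tail-combination (λ i → α (suc i)) ρ₀ ≡⟨ rel ρ₀ ⟩
      0#                                                        ∎)
      where
      open ≡-Reasoning
      T≡0 : tail-combination (λ i → α (suc i)) ρ₀ ≡ 0#
      T≡0 = ∑-zero {k} λ i → trans (cong (_* v (suc i) ρ₀) (tail≡0 i)) (zeroˡ _)

    reduced-independent : LinearlyIndependent v → LinearlyIndependent reduced
    reduced-independent li α rel i = li (extend α) (extend-relation α rel) (suc i)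

    reduced-weakly-independent : WeaklyIndependent v → WeaklyIndependent reduced
    reduced-weakly-independent wi α rel i = wi (extend α) (extend-relation α rel) (suc i)

    independent-if-reduced : LinearlyIndependent reduced → LinearlyIndependent v
    independent-if-reduced li α rel zero = head-zero α rel (li _ (tail-relation α rel))
    independent-if-reduced li α rel (suc i) = li _ (tail-relation α rel) i

  weakly-independent⇒independent : ∀ {k R} (v : Family k R) → WeaklyIndependent v → LinearlyIndependent v
  weakly-independent⇒independent {zero} v wi α rel ()
  weakly-independent⇒independent {suc k} {R} v wi with nonzero-coordinate v wi
  weakly-independent⇒independent {suc k} {zero} v wi | () , _
  weakly-independent⇒independent {suc k} {suc R} v wi | ρ₀ , v₀≢0 with inverse _ v₀≢0
  ... | u , pu = independent-if-reduced (weakly-independent⇒independent reduced (reduced-weakly-independent wi))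
    where open Elimination v ρ₀ u pu

  independent⇒weakly-independent : ∀ {k R} {v : Family k R} → LinearlyIndependent v → WeaklyIndependent v
  independent⇒weakly-independent li α rel i α≢0 = α≢0 (li α rel i)

  independent⇒≤ : ∀ {k R} (v : Family k R) → LinearlyIndependent v → k ≤ R
  independent⇒≤ {zero} v li = z≤n
  independent⇒≤ {suc k} {R} v li with nonzero-coordinate v (independent⇒weakly-independent {v = v} li)
  independent⇒≤ {suc k} {zero} v li | () , _
  independent⇒≤ {suc k} {suc R} v li | ρ₀ , v₀≢0 with inverse _ v₀≢0
  ... | u , pu = s≤s (independent⇒≤ reduced (reduced-independent li))
    where open Elimination v ρ₀ u pu

  LinearlyIndependent-stable : ∀ {k R} (v : Family k R) → ¬ ¬ LinearlyIndependent v → LinearlyIndependent v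
  LinearlyIndependent-stable v ¬¬li =
    weakly-independent⇒independent v λ α rel i α≢0 → ¬¬li λ li → α≢0 (li α rel i)

  ¬independent⇒¬¬nontrivial : ∀ {k R} (v : Family k R) → ¬ LinearlyIndependent v → ¬ ¬ NontrivialRelation v
  ¬independent⇒¬¬nontrivial v ¬li no-relation =
    ¬li (weakly-independent⇒independent v λ α rel i α≢0 → no-relation (α , rel , i , α≢0))

  -- A relation of v ∘ σ is pushed forward along σ to a relation of v.
  independent-reindex : ∀ {k K R} (v : Family K R) (σ : Fin k → Fin K) → Injective _≡_ _≡_ σ →
    LinearlyIndependent v → LinearlyIndependent (λ a → v (σ a))
  independent-reindex {k} {K} v σ σ-inj li α rel a = begin
    α a
      ≡⟨ sym (∑-δ a α) ⟩
    ∑[ b < k ] (δ a b * α b)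
      ≡⟨ ∑-cong (λ b → trans (*-comm _ _) (cong (α b *_) (sym (δ-injective σ-inj b a)))) ⟩
    μ (σ a)
      ≡⟨ li μ μ-relation (σ a) ⟩
    0# ∎
    where
    open ≡-Reasoning
    μ : Fin K → Carrier
    μ i = ∑[ b < k ] (α b * δ (σ b) i)
    μ-relation : IsRelation v μ
    μ-relation ρ = begin
      ∑[ i < K ] (μ i * v i ρ)
        ≡⟨ sym (∑-∑-reassoc α (λ b → δ (σ b)) (λ i → v i ρ)) ⟩
      ∑[ b < k ] (α b * ∑[ i < K ] (δ (σ b) i * v i ρ))
        ≡⟨ ∑-cong (λ b → cong (α b *_) (∑-δ (σ b) (λ i → v i ρ))) ⟩
      ∑[ b < k ] (α b * v (σ b) ρ)
        ≡⟨ rel ρ ⟩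
      0# ∎
      where open ≡-Reasoning

  leading-coefficient≢0 : ∀ {t R} (x : Fin R → Carrier) (w : Family t R) → LinearlyIndependent w →
    ∀ α → IsRelation (x ◂ w) α → (∃ λ i → ¬ α i ≡ 0#) → ¬ α zero ≡ 0#
  leading-coefficient≢0 x w w-li α rel (i , αᵢ≢0) α₀≡0 = αᵢ≢0 (α≡0 i)
    where
    tail-relation : IsRelation w (λ j → α (suc j))
    tail-relation ρ = begin
      ∑[ j < _ ] (α (suc j) * w j ρ)
        ≡⟨ sym (+-identityˡ _) ⟩
      0# + ∑[ j < _ ] (α (suc j) * w j ρ)
        ≡⟨ cong (_+ ∑[ j < _ ] (α (suc j) * w j ρ)) (sym (trans (cong (_* x ρ) α₀≡0) (zeroˡ (x ρ)))) ⟩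
      α zero * x ρ + ∑[ j < _ ] (α (suc j) * w j ρ)
        ≡⟨ rel ρ ⟩
      0# ∎
      where open ≡-Reasoning
    α≡0 : ∀ i → α i ≡ 0#
    α≡0 zero = α₀≡0
    α≡0 (suc j) = w-li _ tail-relation j

  -- The leading coefficients of the relations expressing each u a through w are nonzero,
  -- so their remaining coefficients form t + 1 independent vectors in a t-dimensional space.
  ¬all-dependent : ∀ {t R} (w : Family t R) → LinearlyIndependent w → (u : Family (suc t) R) →
    LinearlyIndependent u → ¬ (∀ a → ¬ LinearlyIndependent (u a ◂ w))
  ¬all-dependent {t} w w-li u u-li dependent =
    ¬¬-∀Fin (λ a → ¬independent⇒¬¬nontrivial (u a ◂ w) (dependent a)) λ relations →
      ℕ.<-irrefl refl (independent⇒≤ (λ a b → proj₁ (relations a) (suc b)) (coefficients-independent relations))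
    where
    coefficients-independent : (relations : ∀ a → NontrivialRelation (u a ◂ w)) →
      LinearlyIndependent (λ a b → proj₁ (relations a) (suc b))
    coefficients-independent relations ν ν-relation a =
      ≢0∧*≡0⇒≡0 (Λ₀≢0 a) (trans (*-comm _ _) (u-li κ κ-relation a))
      where
      Λ : Fin (suc t) → Fin (suc t) → Carrier
      Λ a = proj₁ (relations a)
      Λ₀≢0 : ∀ a → ¬ Λ a zero ≡ 0#
      Λ₀≢0 a = leading-coefficient≢0 (u a) w w-li (Λ a) (proj₁ (proj₂ (relations a))) (proj₂ (proj₂ (relations a)))
      κ : Fin (suc t) → Carrier
      κ a = ν a * Λ a zero
      κ-relation : IsRelation u κ
      κ-relation ρ = begin
        ∑[ a < suc t ] (κ a * u a ρ)
          ≡⟨ sym (+-identityʳ _) ⟩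
        ∑[ a < suc t ] (κ a * u a ρ) + 0#
          ≡⟨ cong (∑[ a < suc t ] (κ a * u a ρ) +_) (sym νX≡0) ⟩
        ∑[ a < suc t ] (κ a * u a ρ) + ∑[ a < suc t ] (ν a * X a)
          ≡⟨ sym (∑-distrib-+ (λ a → κ a * u a ρ) (λ a → ν a * X a)) ⟩
        ∑[ a < suc t ] (κ a * u a ρ + ν a * X a)
          ≡⟨ ∑-cong (λ a → trans (cong (_+ ν a * X a) (*-assoc (ν a) (Λ a zero) (u a ρ))) (sym (distribˡ (ν a) _ _))) ⟩
        ∑[ a < suc t ] (ν a * (Λ a zero * u a ρ + X a))
          ≡⟨ ∑-zero {suc t} (λ a → trans (cong (ν a *_) (proj₁ (proj₂ (relations a)) ρ)) (zeroʳ (ν a))) ⟩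
        0# ∎
        where
        open ≡-Reasoning
        X : Fin (suc t) → Carrier
        X a = ∑[ b < t ] (Λ a (suc b) * w b ρ)
        νX≡0 : ∑[ a < suc t ] (ν a * X a) ≡ 0#
        νX≡0 = trans (∑-∑-reassoc ν (λ a b → Λ a (suc b)) (λ b → w b ρ))
                     (∑-zero {t} λ b → trans (cong (_* w b ρ) (ν-relation b)) (zeroˡ (w b ρ)))

  ¬independent-repeated : ∀ {R} (v : Family 2 R) → (∀ ρ → v zero ρ ≡ v (suc zero) ρ) → ¬ LinearlyIndependent v
  ¬independent-repeated v v₀≡v₁ li = 1≢0 (li (1# ◂ - 1# ◂ []) relation zero)
    where
    relation : IsRelation v (1# ◂ - 1# ◂ [])
    relation ρ = begin
      1# * v zero ρ + (- 1# * v (suc zero) ρ + 0#)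
        ≡⟨ cong₂ (λ x y → x + (y + 0#)) (*-identityˡ _) (-1*x≈-x _) ⟩
      v zero ρ + (- v (suc zero) ρ + 0#)
        ≡⟨ cong (λ y → v zero ρ + (- y + 0#)) (sym (v₀≡v₁ ρ)) ⟩
      v zero ρ + (- v zero ρ + 0#)
        ≡⟨ cong (v zero ρ +_) (+-identityʳ _) ⟩
      v zero ρ + - v zero ρ
        ≡⟨ -‿inverseʳ _ ⟩
      0# ∎
      where open ≡-Reasoning

module Subsets where
  open import Data.Nat using (_≤_)
  open import Data.Vec using ([]; _∷_; here; there)
  open import Data.Fin.Subset using (Subset; inside; outside; _∈_; _⊆_; ∣_∣; ⊤; ⁅_⁆; _∪_) renaming (⊥ to ∅)
  open import Data.Fin.Subset.Properties using (∉⊥; x∈⁅x⁆; x∈⁅y⁆⇒x≡y; x∈p∪q⁺; x∈p∪q⁻; s⊆s; ⊆⊤; ∣⊤∣≡n)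

  enum : ∀ {n} (p : Subset n) → Fin ∣ p ∣ → Fin n
  enum (inside ∷ p) zero = zero
  enum (inside ∷ p) (suc i) = suc (enum p i)
  enum (outside ∷ p) i = suc (enum p i)

  enum-∈ : ∀ {n} (p : Subset n) i → enum p i ∈ p
  enum-∈ (inside ∷ p) zero = here
  enum-∈ (inside ∷ p) (suc i) = there (enum-∈ p i)
  enum-∈ (outside ∷ p) i = there (enum-∈ p i)

  enum-injective : ∀ {n} (p : Subset n) → Injective _≡_ _≡_ (enum p)
  enum-injective (inside ∷ p) {zero} {zero} _ = refl
  enum-injective (inside ∷ p) {suc i} {suc j} eq = cong suc (enum-injective p (Fin.suc-injective eq))
  enum-injective (outside ∷ p) eq = enum-injective p (Fin.suc-injective eq)

  position : ∀ {n} {p : Subset n} {x} → x ∈ p → Fin ∣ p ∣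
  position {p = inside ∷ p} here = zero
  position {p = inside ∷ p} (there x∈p) = suc (position x∈p)
  position {p = outside ∷ p} (there x∈p) = position x∈p

  enum-position : ∀ {n} {p : Subset n} {x} (x∈p : x ∈ p) → enum p (position x∈p) ≡ x
  enum-position {p = inside ∷ p} here = refl
  enum-position {p = inside ∷ p} (there x∈p) = cong suc (enum-position x∈p)
  enum-position {p = outside ∷ p} (there x∈p) = cong suc (enum-position x∈p)

  image : ∀ {k n} → (Fin k → Fin n) → Subset n
  image {zero} ι = ∅
  image {suc k} ι = ⁅ ι zero ⁆ ∪ image (λ a → ι (suc a))

  ∈-image : ∀ {k n} (ι : Fin k → Fin n) a → ι a ∈ image ι
  ∈-image ι zero = x∈p∪q⁺ (inj₁ (x∈⁅x⁆ (ι zero)))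
  ∈-image ι (suc a) = x∈p∪q⁺ (inj₂ (∈-image (λ a → ι (suc a)) a))

  preimage : ∀ {k n} (ι : Fin k → Fin n) {x} → x ∈ image ι → ∃ λ a → ι a ≡ x
  preimage {zero} ι x∈⊥ = ⊥-elim (∉⊥ x∈⊥)
  preimage {suc k} ι x∈ with x∈p∪q⁻ ⁅ ι zero ⁆ _ x∈
  ... | inj₁ x∈⁅ι₀⁆ = zero , sym (x∈⁅y⁆⇒x≡y (ι zero) x∈⁅ι₀⁆)
  ... | inj₂ x∈rest with preimage (λ a → ι (suc a)) x∈rest
  ...   | a , ιa≡x = suc a , ιa≡x

  ∣image∣≤ : ∀ {k n} (ι : Fin k → Fin n) → ∣ image ι ∣ ≤ k
  ∣image∣≤ ι = Fin.injective⇒≤ {f = pick} pick-injective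
    where
    pick : Fin ∣ image ι ∣ → _
    pick b = proj₁ (preimage ι (enum-∈ (image ι) b))
    pick-injective : Injective _≡_ _≡_ pick
    pick-injective {b} {b'} eq = enum-injective (image ι) (begin
      enum (image ι) b        ≡⟨ sym (proj₂ (preimage ι (enum-∈ (image ι) b))) ⟩
      ι (pick b)              ≡⟨ cong ι eq ⟩
      ι (pick b')             ≡⟨ proj₂ (preimage ι (enum-∈ (image ι) b')) ⟩
      enum (image ι) b'       ∎)
      where open ≡-Reasoning

  extend : ∀ {n t} (p : Subset n) → ∣ p ∣ ≤ t → t ≤ n → ∃ λ q → p ⊆ q × ∣ q ∣ ≡ t
  extend [] z≤n z≤n = [] , (λ x∈ → x∈) , refl
  extend {t = suc t} (inside ∷ p) (s≤s p≤t) (s≤s t≤n) with extend p p≤t t≤n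
  ... | q , p⊆q , ∣q∣≡t = inside ∷ q , s⊆s p⊆q , cong suc ∣q∣≡t
  extend {suc n} {t} (outside ∷ p) p≤t t≤1+n with t ℕ.≟ suc n
  ... | yes refl = ⊤ , ⊆⊤ , ∣⊤∣≡n (suc n)
  ... | no t≢1+n with extend p p≤t (ℕ.≤-pred (ℕ.≤∧≢⇒< t≤1+n t≢1+n))
  ...   | q , p⊆q , ∣q∣≡t = outside ∷ q , s⊆s p⊆q , ∣q∣≡t

module Counting where
  open import Data.Nat using (_≤_; _<_; _*_; _+_; _⊓_; _<?_; _≤?_)
  open import Data.Nat.Combinatorics using (_C_; nCn≡1; nCk+nC[k+1]≡[n+1]C[k+1])
  open import Data.Vec using ([]; _∷_)
  open import Data.Fin.Subset using (Subset; inside; outside; ∣_∣)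
  open import Data.List using (List; []; _∷_; [_]; _++_; map; length; filter; allFin; lookup)
  open import Data.List.Properties using (length-map; length-++; length-tabulate)
  open import Data.List.Membership.Propositional using () renaming (_∈_ to _∈ₗ_)
  open import Data.List.Membership.Propositional.Properties using (∈-map⁺; ∈-++⁺ˡ; ∈-++⁺ʳ; ∈-lookup)
  open import Data.List.Relation.Unary.Any using (here; there)
  open import Data.List.Relation.Unary.All as All using (All; []; _∷_)
  open import Data.List.Relation.Unary.All.Properties using (all-filter; filter⁺; tabulate⁺)
  open import Data.List.Relation.Unary.AllPairs using ([]; _∷_)
  open import Data.List.Relation.Unary.Unique.Propositional using (Unique)
  import Data.List.Relation.Unary.Unique.Propositional.Properties as Unique
  import Data.List.Relation.Binary.Sublist.Propositional.Properties as Sublist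
  open import Data.List.Relation.Binary.Sublist.Heterogeneous.Properties using (length-mono-≤)
  open import Relation.Binary.Definitions using (DecidableEquality)
  open import Relation.Unary using (Decidable)
  open import Relation.Nullary using (¬?)

  subsetsOfSize : (n t : ℕ) → List (Subset n)
  subsetsOfSize zero zero = [ [] ]
  subsetsOfSize zero (suc t) = []
  subsetsOfSize (suc n) zero = map (outside ∷_) (subsetsOfSize n zero)
  subsetsOfSize (suc n) (suc t) = map (inside ∷_) (subsetsOfSize n t) ++ map (outside ∷_) (subsetsOfSize n (suc t))

  length-subsetsOfSize : (n t : ℕ) → length (subsetsOfSize n t) ≡ n C t
  length-subsetsOfSize zero zero = refl
  length-subsetsOfSize zero (suc t) = refl
  length-subsetsOfSize (suc n) zero = trans (length-map _ (subsetsOfSize n zero)) (length-subsetsOfSize n zero)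
  length-subsetsOfSize (suc n) (suc t) = begin
    length (map (inside ∷_) (subsetsOfSize n t) ++ map (outside ∷_) (subsetsOfSize n (suc t)))
      ≡⟨ length-++ (map (inside ∷_) (subsetsOfSize n t)) ⟩
    length (map (inside ∷_) (subsetsOfSize n t)) + length (map (outside ∷_) (subsetsOfSize n (suc t)))
      ≡⟨ cong₂ _+_ (length-map _ (subsetsOfSize n t)) (length-map _ (subsetsOfSize n (suc t))) ⟩
    length (subsetsOfSize n t) + length (subsetsOfSize n (suc t))
      ≡⟨ cong₂ _+_ (length-subsetsOfSize n t) (length-subsetsOfSize n (suc t)) ⟩
    n C t + n C suc t
      ≡⟨ nCk+nC[k+1]≡[n+1]C[k+1] n t ⟩
    suc n C suc t ∎
    where open ≡-Reasoning

  ∈-subsetsOfSize : ∀ {n} (p : Subset n) → p ∈ₗ subsetsOfSize n ∣ p ∣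
  ∈-subsetsOfSize [] = here refl
  ∈-subsetsOfSize (inside ∷ p) = ∈-++⁺ˡ (∈-map⁺ (inside ∷_) (∈-subsetsOfSize p))
  ∈-subsetsOfSize {suc n} (outside ∷ p) with ∣ p ∣ | ∈-subsetsOfSize p
  ... | zero | p∈ = ∈-map⁺ (outside ∷_) p∈
  ... | suc t | p∈ = ∈-++⁺ʳ (map (inside ∷_) (subsetsOfSize n t)) (∈-map⁺ (outside ∷_) p∈)

  length-filter-split : ∀ {A : Set} {P : A → Set} (P? : Decidable P) xs →
    length (filter P? xs) + length (filter (λ x → ¬? (P? x)) xs) ≡ length xs
  length-filter-split P? [] = refl
  length-filter-split P? (x ∷ xs) with P? x
  ... | yes _ = cong suc (length-filter-split P? xs)
  ... | no _ = trans (ℕ.+-suc _ _) (cong suc (length-filter-split P? xs))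

  pigeonhole : ∀ {A B : Set} (_≟_ : DecidableEquality B) (f : A → B) (bs : List B) c (xs : List A) →
    All (λ x → f x ∈ₗ bs) xs → length bs * c < length xs →
    ∃ λ b → c < length (filter (λ x → f x ≟ b) xs)
  pigeonhole _≟_ f [] c [] _ ()
  pigeonhole _≟_ f [] c (x ∷ xs) (() ∷ _) _
  pigeonhole _≟_ f (b ∷ bs) c xs f∈ many with c <? length (filter (λ x → f x ≟ b) xs)
  ... | yes c<fibre = b , c<fibre
  ... | no c≮fibre with pigeonhole _≟_ f bs c rest rest∈bs rest-many
    where
    rest = filter (λ x → ¬? (f x ≟ b)) xs
    rest∈bs : All (λ x → f x ∈ₗ bs) rest
    rest∈bs = All.zipWith (λ { (here fx≡b , fx≢b) → ⊥-elim (fx≢b fx≡b) ; (there fx∈bs , _) → fx∈bs })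
                (filter⁺ _ f∈ , all-filter _ xs)
    rest-many : length bs * c < length rest
    rest-many = ℕ.+-cancelˡ-< c _ _ (ℕ.<-≤-trans many (begin
      length xs
        ≡⟨ sym (length-filter-split (λ x → f x ≟ b) xs) ⟩
      length (filter (λ x → f x ≟ b) xs) + length rest
        ≤⟨ ℕ.+-monoˡ-≤ (length rest) (ℕ.≮⇒≥ c≮fibre) ⟩
      c + length rest                                             ∎))
      where open ℕ.≤-Reasoning
  ... | b' , c<fibre' = b' , ℕ.<-≤-trans c<fibre'
          (length-mono-≤ (Sublist.filter⁺ _ _ (λ { refl fx≡b' → fx≡b' }) (Sublist.filter-⊆ _ xs)))

  lookup-injective : ∀ {A : Set} {xs : List A} → Unique xs → Injective _≡_ _≡_ (lookup xs)
  lookup-injective (_ ∷ _) {zero} {zero} _ = refl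
  lookup-injective (x∉xs ∷ _) {zero} {suc j} eq = ⊥-elim (All.lookup x∉xs (∈-lookup j) eq)
  lookup-injective (x∉xs ∷ _) {suc i} {zero} eq = ⊥-elim (All.lookup x∉xs (∈-lookup i) (sym eq))
  lookup-injective (_ ∷ xs!) {suc i} {suc j} eq = cong suc (lookup-injective xs! eq)

  pigeonholeᶠ : ∀ {N} {B : Set} (_≟_ : DecidableEquality B) (f : Fin N → B) (bs : List B) c →
    (∀ j → f j ∈ₗ bs) → length bs * c < N →
    ∃ λ b → ∃ λ (h : Fin (suc c) → Fin N) → Injective _≡_ _≡_ h × ∀ a → f (h a) ≡ b
  pigeonholeᶠ {N} _≟_ f bs c f∈bs many
    with pigeonhole _≟_ f bs c (allFin N) (tabulate⁺ f∈bs)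
           (subst (length bs * c <_) (sym (length-tabulate (λ j → j))) many)
  ... | b , c<fibre =
    b , h , h-injective , λ a → All.lookup (all-filter (λ j → f j ≟ b) (allFin N)) (∈-lookup _)
    where
    h : Fin (suc c) → Fin N
    h a = lookup (filter (λ j → f j ≟ b) (allFin N)) (inject≤ a c<fibre)
    h-injective : Injective _≡_ _≡_ h
    h-injective eq = Fin.inject≤-injective c<fibre c<fibre _ _
      (lookup-injective (Unique.filter⁺ (λ j → f j ≟ b) (Unique.allFin⁺ N)) eq)

  A-bound : ∀ d n → (n ⊓ d) * (n C (n ⊓ d)) < A d (suc n)
  A-bound d n with suc n ≤? suc d
  ... | yes 1+n≤1+d = subst (λ s → s * (n C s) < suc n) (sym (ℕ.m≤n⇒m⊓n≡m (ℕ.≤-pred 1+n≤1+d))) (begin-strict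
    n * (n C n)   ≡⟨ cong (n *_) (nCn≡1 n) ⟩
    n * 1         ≡⟨ ℕ.*-identityʳ n ⟩
    n             <⟨ ℕ.n<1+n n ⟩
    suc n         ∎)
    where open ℕ.≤-Reasoning
  ... | no 1+n≰1+d = subst (λ s → s * (n C s) < d * (n C d) + 1) (sym (ℕ.m≥n⇒m⊓n≡n d≤n)) (ℕ.m<m+n _ (s≤s z≤n))
    where
    d≤n : d ≤ n
    d≤n = ℕ.<⇒≤ (ℕ.≤-pred (ℕ.≰⇒> 1+n≰1+d))

module AffineGeometry (ℝ : RealField) (d : ℕ) where
  open OrderedField ℝ
  open LinearAlgebra ℝ
  open Subsets using (enum; position; enum-position)
  open import Data.Nat using (_≤_)
  open import Data.Vec using (lookup)
  open import Data.Vec.Functional using ([]) renaming (_∷_ to _◂_)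
  open import Data.Fin.Subset using (Subset; _∈_)

  Pt : Set
  Pt = Point ℝ d

  AI : ∀ {k} → (Fin k → Pt) → Set
  AI = AffinelyIndependent ℝ

  GP : ∀ {n} → (Fin n → Pt) → Set
  GP = InGeneralPosition ℝ

  lift : Pt → Fin (suc d) → Carrier
  lift x zero = 1#
  lift x (suc c) = lookup x c

  homogenize : ∀ {k} → (Fin k → Pt) → Family k (suc d)
  homogenize p i = lift (p i)

  AI⇒independent : ∀ {k} (p : Fin k → Pt) → AI p → LinearlyIndependent (homogenize p)
  AI⇒independent p ai α rel = ai α
    (trans (sumF≡sum α) (trans (sym (∑-cong λ i → *-identityʳ (α i))) (rel zero)))
    (λ c → trans (sumF≡sum (λ i → α i * lookup (p i) c)) (rel (suc c)))

  independent⇒AI : ∀ {k} (p : Fin k → Pt) → LinearlyIndependent (homogenize p) → AI p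
  independent⇒AI p li α ∑α≡0 ∑αp≡0 = li α λ
    { zero → trans (∑-cong λ i → *-identityʳ (α i)) (trans (sym (sumF≡sum α)) ∑α≡0)
    ; (suc c) → trans (sym (sumF≡sum (λ i → α i * lookup (p i) c))) (∑αp≡0 c) }

  AI-cong : ∀ {k} {p q : Fin k → Pt} → (∀ i → p i ≡ q i) → AI p → AI q
  AI-cong {p = p} {q} p≡q ai = independent⇒AI q
    (LinearlyIndependent-cong (λ i ρ → cong (λ x → lift x ρ) (p≡q i)) (AI⇒independent p ai))

  AI-stable : ∀ {k} (p : Fin k → Pt) → ¬ ¬ AI p → AI p
  AI-stable p ¬¬ai = independent⇒AI p (LinearlyIndependent-stable _ λ ¬li → ¬¬ai (¬li ∘ AI⇒independent p))

  AI-reindex : ∀ {k K} (p : Fin K → Pt) (σ : Fin k → Fin K) → Injective _≡_ _≡_ σ → AI p → AI (λ a → p (σ a))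
  AI-reindex p σ σ-inj ai = independent⇒AI _ (independent-reindex (homogenize p) σ σ-inj (AI⇒independent p ai))

  AI-⊆ : ∀ {k n} (y : Fin n → Pt) (q : Subset n) (ι : Fin k → Fin n) → Injective _≡_ _≡_ ι →
    (ι∈q : ∀ a → ι a ∈ q) → AI (λ b → y (enum q b)) → AI (λ a → y (ι a))
  AI-⊆ y q ι ι-inj ι∈q ai = AI-cong (λ a → cong y (enum-position (ι∈q a)))
    (AI-reindex (λ b → y (enum q b)) (λ a → position (ι∈q a)) σ-inj ai)
    where
    σ-inj : Injective _≡_ _≡_ (λ a → position (ι∈q a))
    σ-inj {a} {b} eq = ι-inj (trans (sym (enum-position (ι∈q a))) (trans (cong (enum q) eq) (enum-position (ι∈q b))))

  ¬all-dependent-extensions : ∀ {t} (T : Fin t → Pt) → AI T → (Z : Fin (suc t) → Pt) → AI Z →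
    ¬ (∀ a → ¬ AI (Z a ◂ T))
  ¬all-dependent-extensions T T-ai Z Z-ai dependent =
    ¬all-dependent (homogenize T) (AI⇒independent T T-ai) (homogenize Z) (AI⇒independent Z Z-ai) λ a li →
      dependent a (independent⇒AI (Z a ◂ T)
        (LinearlyIndependent-cong {v = lift (Z a) ◂ homogenize T} {w = homogenize (Z a ◂ T)}
          (λ { zero ρ → refl ; (suc i) ρ → refl }) li))

  GP-reindex : ∀ {n m} (y : Fin n → Pt) (σ : Fin m → Fin n) → Injective _≡_ _≡_ σ → GP y → GP (λ i → y (σ i))
  GP-reindex y σ σ-inj gp k k≤ ι ι-inj = gp k k≤ (λ j → σ (ι j)) (ι-inj ∘ σ-inj)

  GP-stable : ∀ {n} (y : Fin n → Pt) → ¬ ¬ GP y → GP y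
  GP-stable y ¬¬gp k k≤ ι ι-inj = AI-stable (λ j → y (ι j)) λ ¬ai → ¬¬gp λ gp → ¬ai (gp k k≤ ι ι-inj)

  GP⇒injective : 1 ≤ d → ∀ {n} (y : Fin n → Pt) → GP y → Injective _≡_ _≡_ y
  GP⇒injective 1≤d y gp {a} {b} ya≡yb with a Fin.≟ b
  ... | yes a≡b = a≡b
  ... | no a≢b = ⊥-elim (¬independent-repeated (homogenize (λ j → y (pair j)))
          (λ ρ → cong (λ x → lift x ρ) ya≡yb)
          (AI⇒independent (λ j → y (pair j)) (gp 2 (s≤s 1≤d) pair pair-injective)))
    where
    pair : Fin 2 → Fin _
    pair = a ◂ b ◂ []
    pair-injective : Injective _≡_ _≡_ pair
    pair-injective {zero} {zero} _ = refl
    pair-injective {zero} {suc zero} a≡b = ⊥-elim (a≢b a≡b)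
    pair-injective {suc zero} {zero} b≡a = ⊥-elim (a≢b (sym b≡a))
    pair-injective {suc zero} {suc zero} _ = refl

module Extension (ℝ : RealField) (d : ℕ) where
  open OrderedField ℝ using (search)
  open AffineGeometry ℝ d
  open Subsets
  open Counting
  open import Data.Nat using (_≤_; _*_; _<_; _⊓_)
  open import Data.Nat.Combinatorics using (_C_)
  open import Data.Fin.Patterns using (0F)
  open import Data.List using (length)
  open import Data.List.Membership.Propositional using () renaming (_∈_ to _∈ₗ_)
  open import Data.Vec using (_∷_)
  open import Data.Vec.Functional using () renaming (_∷_ to _◂_)
  open import Data.Vec.Properties using (≡-dec)
  open import Data.Bool.Properties using () renaming (_≟_ to _≟ᵇ_)
  open import Data.Fin.Subset using (Subset; inside; outside; ∣_∣)
  open import Data.Fin.Subset.Properties using (∣p∣≤n)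

  module _ {n} (S : Fin n → Pt) (S-gp : GP S) where

    t : ℕ
    t = n ⊓ d

    Blocks : Subset n → Pt → Set
    Blocks T z = ¬ AI (z ◂ λ b → S (enum T b))

    -- A dependent subfamily of z ◂ S lies in a (t+1)-subset of indices, which must contain z
    -- because S is in general position.
    blocking-subset : ∀ z → ¬ GP (z ◂ S) → ¬ ¬ (∃ λ T → ∣ T ∣ ≡ t × Blocks T z)
    blocking-subset z ¬gp no-blocking = ¬gp λ k k≤1+d ι ι-inj →
      AI-stable (λ a → (z ◂ S) (ι a)) λ ¬ai → no-blocking (witness k k≤1+d ι ι-inj ¬ai)
      where
      witness : ∀ k → k ≤ suc d → (ι : Fin k → Fin (suc n)) → Injective _≡_ _≡_ ι →
        ¬ AI (λ a → (z ◂ S) (ι a)) → ∃ λ T → ∣ T ∣ ≡ t × Blocks T z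
      witness k k≤1+d ι ι-inj ¬ai
        with extend (image ι) (ℕ.⊓-glb (∣p∣≤n (image ι)) (ℕ.≤-trans (∣image∣≤ ι) k≤1+d)) (s≤s (ℕ.m⊓n≤m n d))
      ... | inside ∷ T , ι⊆ , ∣T∣≡1+t = T , ℕ.suc-injective ∣T∣≡1+t , λ ai →
            ¬ai (AI-⊆ (z ◂ S) (inside ∷ T) ι ι-inj (λ a → ι⊆ (∈-image ι a))
                  (AI-cong {p = z ◂ λ b → S (enum T b)} {q = λ b → (z ◂ S) (enum (inside ∷ T) b)}
                    (λ { zero → refl ; (suc b) → refl }) ai))
      ... | outside ∷ T , ι⊆ , ∣T∣≡1+t =
            ⊥-elim (¬ai (AI-⊆ (z ◂ S) (outside ∷ T) ι ι-inj (λ a → ι⊆ (∈-image ι a))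
              (S-gp ∣ T ∣ (subst (_≤ suc d) (sym ∣T∣≡1+t) (s≤s (ℕ.m⊓n≤n n d))) (enum T) (enum-injective T))))

    unblockable : ∀ {r} T → ∣ T ∣ ≡ r → r ≤ d → (Z : Fin (suc r) → Pt) → AI Z → ¬ (∀ a → Blocks T (Z a))
    unblockable T refl ∣T∣≤d = ¬all-dependent-extensions (λ b → S (enum T b))
      (S-gp ∣ T ∣ (ℕ.m≤n⇒m≤1+n ∣T∣≤d) (enum T) (enum-injective T))

    -- A t-subset of S blocks at most t points of Z, and t · (n C t) < A d (suc n).
    ¬all-blocked : ∀ {N} (Z : Fin N → Pt) → GP Z → A d (suc n) ≤ N →
      ¬ (∀ j → ∃ λ T → ∣ T ∣ ≡ t × Blocks T (Z j))
    ¬all-blocked {N} Z Z-gp A≤N blocking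
      with pigeonholeᶠ (≡-dec _≟ᵇ_) (λ j → proj₁ (blocking j)) (subsetsOfSize n t) t blocker-of-size-t many
      where
      blocker-of-size-t : ∀ j → proj₁ (blocking j) ∈ₗ subsetsOfSize n t
      blocker-of-size-t j = subst (λ s → proj₁ (blocking j) ∈ₗ subsetsOfSize n s) (proj₁ (proj₂ (blocking j)))
                              (∈-subsetsOfSize (proj₁ (blocking j)))
      many : length (subsetsOfSize n t) * t < N
      many = ℕ.<-≤-trans (subst (_< A d (suc n)) t*C≡length*t (A-bound d n)) A≤N
        where
        t*C≡length*t : t * (n C t) ≡ length (subsetsOfSize n t) * t
        t*C≡length*t = trans (ℕ.*-comm t _) (cong (_* t) (sym (length-subsetsOfSize n t)))
    ... | T , h , h-injective , T-h =
      unblockable T (trans (sym (cong ∣_∣ (T-h 0F))) (proj₁ (proj₂ (blocking (h 0F))))) (ℕ.m⊓n≤n n d)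
        (λ a → Z (h a)) (Z-gp (suc t) (s≤s (ℕ.m⊓n≤n n d)) h h-injective)
        (λ a → subst (λ T → Blocks T (Z (h a))) (T-h a) (proj₂ (proj₂ (blocking (h a)))))

    extension : ∀ {N} (Z : Fin N → Pt) → GP Z → A d (suc n) ≤ N → ∃ λ j → GP (Z j ◂ S)
    extension Z Z-gp A≤N with search (λ j → GP (Z j ◂ S))
    ... | inj₁ (j , ¬¬gp) = j , GP-stable (Z j ◂ S) ¬¬gp
    ... | inj₂ ¬gp = ⊥-elim (¬¬-∀Fin (λ j → blocking-subset (Z j) (¬gp j)) (¬all-blocked Z Z-gp A≤N))

module Representatives (ℝ : RealField) (d : ℕ) where
  open AffineGeometry ℝ d
  open Counting using (pigeonholeᶠ)
  open import Data.Nat using (_≤_; _*_; _+_; _<_)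
  open import Data.Vec using (Vec; _∷_; insertAt; lookup)
  open import Data.Vec.Properties using (insertAt-lookup; insertAt-punchIn; []=⇒lookup; lookup⇒[]=)
  open import Data.Vec.Functional using () renaming (_∷_ to _◂_)
  open import Data.Fin.Subset using (Subset; inside; outside; _∈_; ∣_∣; ⊤; Nonempty)
  open import Data.List using (List; allFin; length)
  open import Data.List.Properties using (length-tabulate)
  open import Data.List.Membership.Propositional using () renaming (_∈_ to _∈ₗ_)
  open import Data.List.Membership.Propositional.Properties using (∈-allFin)
  open import Function using (id)

  φ≥-weaken : ∀ {P Q : Pt → Set} {k k'} → (∀ p → P p → Q p) → k ≡ k' → φ≥ ℝ P k → φ≥ ℝ Q k'
  φ≥-weaken P⊆Q refl (y , y-inj , y∈P , y-gp) = y , y-inj , (λ j → P⊆Q (y j) (y∈P j)) , y-gp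

  crowded-class : ∀ {m} c (X : Fin m → List Pt) → φ≥ ℝ (⋃ ℝ X ⊤) (m * c + 1) →
    ∃ λ i₀ → ∃ λ (Z : Fin (suc c) → Pt) → GP Z × ∀ a → Z a ∈ₗ X i₀
  crowded-class {m} c X (y , _ , y∈⋃X , y-gp)
    with pigeonholeᶠ Fin._≟_ (λ j → proj₁ (y∈⋃X j)) (allFin m) c (λ j → ∈-allFin _) many
    where
    many : length (allFin m) * c < m * c + 1
    many = subst (λ l → l * c < m * c + 1) (sym (length-tabulate {n = m} id)) (ℕ.m<m+n (m * c) (s≤s z≤n))
  ... | i₀ , h , h-injective , class≡i₀ =
    i₀ , (λ a → y (h a)) , GP-reindex y h h-injective y-gp ,
    λ a → subst (λ i → y (h a) ∈ₗ X i) (class≡i₀ a) (proj₂ (proj₂ (y∈⋃X (h a))))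

  ∣insertAt-outside∣ : ∀ {n} (I : Subset n) i → ∣ insertAt I i outside ∣ ≡ ∣ I ∣
  ∣insertAt-outside∣ I zero = refl
  ∣insertAt-outside∣ (inside ∷ I) (suc i) = cong suc (∣insertAt-outside∣ I i)
  ∣insertAt-outside∣ (outside ∷ I) (suc i) = ∣insertAt-outside∣ I i

  ⋃-insertAt-outside : ∀ {n} (X : Fin (suc n) → List Pt) i₀ (I : Subset n) p →
    ⋃ ℝ X (insertAt I i₀ outside) p → ⋃ ℝ (λ i → X (punchIn i₀ i)) I p
  ⋃-insertAt-outside X i₀ I p (i , i∈ , p∈Xi) with i₀ Fin.≟ i
  ... | yes refl with () ← trans (sym (insertAt-lookup I i₀ outside)) ([]=⇒lookup i∈)
  ... | no i₀≢i = punchOut i₀≢i , lookup⇒[]= _ I (begin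
        lookup I (punchOut i₀≢i)
          ≡⟨ sym (insertAt-punchIn I i₀ outside _) ⟩
        lookup (insertAt I i₀ outside) (punchIn i₀ (punchOut i₀≢i))
          ≡⟨ cong (lookup (insertAt I i₀ outside)) (Fin.punchIn-punchOut i₀≢i) ⟩
        lookup (insertAt I i₀ outside) i
          ≡⟨ []=⇒lookup i∈ ⟩
        inside                                                           ∎) ,
      subst (λ i → p ∈ₗ X i) (sym (Fin.punchIn-punchOut i₀≢i)) p∈Xi
    where open ≡-Reasoning

  restrict : ∀ {n} (b : ℕ → ℕ) (X : Fin (suc n) → List Pt) i₀ →
    (∀ I → Nonempty I → φ≥ ℝ (⋃ ℝ X I) (b ∣ I ∣)) →
    (∀ I → Nonempty I → φ≥ ℝ (⋃ ℝ (λ i → X (punchIn i₀ i)) I) (b ∣ I ∣))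
  restrict b X i₀ hyp I (x , x∈I) =
    φ≥-weaken (⋃-insertAt-outside X i₀ I) (cong b (∣insertAt-outside∣ I i₀))
      (hyp (insertAt I i₀ outside)
        (punchIn i₀ x , lookup⇒[]= _ _ (trans (insertAt-punchIn I i₀ outside x) ([]=⇒lookup x∈I))))

  toFront : ∀ {n} → Fin (suc n) → Fin (suc n) → Fin (suc n)
  toFront i₀ i with i₀ Fin.≟ i
  ... | yes _ = zero
  ... | no i₀≢i = suc (punchOut i₀≢i)

  toFront-injective : ∀ {n} (i₀ : Fin (suc n)) → Injective _≡_ _≡_ (toFront i₀)
  toFront-injective i₀ {i} {j} eq with i₀ Fin.≟ i | i₀ Fin.≟ j
  ... | yes i₀≡i | yes i₀≡j = trans (sym i₀≡i) i₀≡j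
  ... | no i₀≢i | no i₀≢j = Fin.punchOut-injective i₀≢i i₀≢j (Fin.suc-injective eq)
  ... | yes _ | no _ with () ← eq
  ... | no _ | yes _ with () ← eq

  insert-representative : 1 ≤ d → ∀ {n} (X : Fin (suc n) → List Pt) i₀ {x} {S : Fin n → Pt} →
    x ∈ₗ X i₀ → (∀ i → S i ∈ₗ X (punchIn i₀ i)) → GP (x ◂ S) → SystemOfGPRepresentatives ℝ X
  insert-representative 1≤d X i₀ {x} {S} x∈ S∈ gp = r , r∈X , GP⇒injective 1≤d r r-gp , r-gp
    where
    r : Fin _ → Pt
    r i = (x ◂ S) (toFront i₀ i)
    r-gp : GP r
    r-gp = GP-reindex (x ◂ S) (toFront i₀) (toFront-injective i₀) gp
    r∈X : ∀ i → r i ∈ₗ X i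
    r∈X i with i₀ Fin.≟ i
    ... | yes refl = x∈
    ... | no i₀≢i = subst (λ j → S (punchOut i₀≢i) ∈ₗ X j) (Fin.punchIn-punchOut i₀≢i) (S∈ (punchOut i₀≢i))

  representatives-of-empty-family : (X : Fin 0 → List Pt) → SystemOfGPRepresentatives ℝ X
  representatives-of-empty-family X = (λ ()) , (λ ()) , (λ { {()} }) , λ _ _ ι _ _ _ _ i → ⊥-elim (Fin.¬Fin0 (ι i))

open import Data.Nat using (_≤_; _∸_)
open import Data.Fin.Subset using (Subset; Nonempty; ∣_∣; ⊤)
open import Data.Fin.Subset.Properties using (∈⊤; ∣⊤∣≡n)
open import Data.List using (List)

theorem2p2 : (ℝ : RealField) (d : ℕ) → 1 ≤ d → (m : ℕ) →
    (X : Fin m → List (Point ℝ d)) →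
    (∀ (I : Subset m) → Nonempty I → φ≥ ℝ (⋃ ℝ X I) (B d ∣ I ∣)) →
    SystemOfGPRepresentatives ℝ X
theorem2p2 ℝ d 1≤d zero X hyp = representatives-of-empty-family X
  where open Representatives ℝ d
theorem2p2 ℝ d 1≤d (suc n) X hyp =
  let i₀ , Z , Z-gp , Z⊆Xi₀ = crowded-class (A d (suc n) ∸ 1) X
        (φ≥-weaken {P = ⋃ ℝ X ⊤} (λ _ p∈ → p∈) (cong (B d) (∣⊤∣≡n (suc n))) (hyp ⊤ (zero , ∈⊤)))
      S , S⊆X , _ , S-gp = theorem2p2 ℝ d 1≤d n (λ i → X (punchIn i₀ i)) (restrict (B d) X i₀ hyp)
      j , Zj◂S-gp = extension S S-gp Z Z-gp (ℕ.m≤n+m∸n (A d (suc n)) 1)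
  in insert-representative 1≤d X i₀ (Z⊆Xi₀ j) S⊆X Zj◂S-gp
  where
  open Representatives ℝ d
  open Extension ℝ d
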